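{- Suppose a vertex $v$ of a graph lies in the support of a $t$-colored distribution and carries $M>t$ pebbles. Then for any integer $E\le M-t$, at least $\lfloor E/2\rfloor$ pebbles initially on $v$ can be placed on an adjacent vertex using color-respecting pebbling steps.
   Context: A distribution of pebbles on a graph assigns a nonnegative number of pebbles to each vertex; its support is the set of vertices with at least one pebble. A $t$-colored distribution is one in which each pebble is assigned one of $t$ colors. A color-respecting pebbling step removes two pebbles of the same color from a vertex and places one pebble of that color on an adjacent vertex. -}

module Defs where

open import Data.Nat using (ℕ; zero; suc; _+_; _∸_; _≤_)
open import Data.Fin using (Fin; _≟_) renaming (zero to fzero; suc to fsuc)
open import Data.Product using (Σ; _×_)
open import Relation.Nullary using (¬_; yes; no)
open import Relation.Binary.PropositionalEquality using (_≡_)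
open import Relation.Binary.Construct.Closure.ReflexiveTransitive using (Star)

record Graph (n : ℕ) : Set₁ where
  field
    Adj     : Fin n → Fin n → Set
    sym     : ∀ {x y} → Adj x y → Adj y x
    irrefl  : ∀ {x} → ¬ Adj x x
open Graph public

-- A t-colored distribution: D x c = number of pebbles of color c on vertex x.
Dist : ℕ → ℕ → Set
Dist n t = Fin n → Fin t → ℕ

ΣFin : ∀ {t} → (Fin t → ℕ) → ℕ
ΣFin {zero}  f = 0
ΣFin {suc t} f = f fzero + ΣFin (λ i → f (fsuc i))

total : ∀ {n t} → Dist n t → Fin n → ℕ
total D x = ΣFin (D x)

move : ∀ {n t} → Dist n t → Fin n → Fin n → Fin t → Dist n t
move D x y c w k with k ≟ c
... | no _ = D w k
... | yes _ with w ≟ x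
...   | yes _ = D w k ∸ 2
...   | no _ with w ≟ y
...     | yes _ = D w k + 1
...     | no _ = D w k

Step : ∀ {n t} → Graph n → Fin n → Fin n → Dist n t → Dist n t → Set
Step G x y D D' =
  Adj G x y × Σ _ (λ c → (2 ≤ D x c) × (∀ w k → D' w k ≡ move D x y c w k))

StepsFromTo : ∀ {n t} → Graph n → Fin n → Fin n → Dist n t → Dist n t → Set
StepsFromTo G x y = Star (Step G x y)

-- Pebble from v to the neighbour u, one step at a time, in any colour that still has two
-- pebbles on v.  When no such colour is left, v holds at most one pebble of each of the t
-- colours, so if k steps were made then M ≤ t + 2k.  Each step adds one pebble to u, and
-- E ≤ M − t ≤ 2k gives ⌊E/2⌋ ≤ k.
module Submission where

open import Defs
open import Data.Nat using (ℕ; _<_; _∸_)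
open import Data.Integer using (ℤ; +_; _-_; _≤_)
open import Data.Integer.DivMod using (_/_)
open import Data.Fin using (Fin)
open import Data.Product using (Σ; _×_)

import Data.Nat as ℕ
import Data.Nat.Properties as ℕ
import Data.Integer as ℤ
import Data.Integer.Properties as ℤ
open import Data.Integer.DivMod using ([n/d]*d≤n)
open import Data.Nat.Induction using (Acc; acc; <-wellFounded)
open import Data.Fin using (_≟_) renaming (zero to fzero; suc to fsuc)
import Data.Fin.Properties as Fin
open import Data.Product using (_,_)
open import Data.Sum using (_⊎_; inj₁; inj₂)
open import Data.Empty using (⊥-elim)
open import Relation.Nullary using (yes; no)
import Relation.Binary.PropositionalEquality as ≡
open import Relation.Binary.PropositionalEquality
  using (_≡_; _≢_; refl; trans; cong; cong₂; subst; module ≡-Reasoning)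
open import Relation.Binary.Construct.Closure.ReflexiveTransitive using (ε; _◅_)

ΣFin-cong : ∀ {t} {f g : Fin t → ℕ} → (∀ i → f i ≡ g i) → ΣFin f ≡ ΣFin g
ΣFin-cong {ℕ.zero}  eq = refl
ΣFin-cong {ℕ.suc t} eq = cong₂ ℕ._+_ (eq fzero) (ΣFin-cong (λ i → eq (fsuc i)))

ΣFin-update : ∀ {t} (f g : Fin t → ℕ) (c : Fin t) (a : ℕ) →
  f c ≡ g c ℕ.+ a → (∀ k → k ≢ c → f k ≡ g k) → ΣFin f ≡ ΣFin g ℕ.+ a
ΣFin-update {ℕ.suc t} f g fzero a fc≡ rest = begin
  f fzero ℕ.+ ΣFin (λ i → f (fsuc i))  ≡⟨ cong₂ ℕ._+_ fc≡ (ΣFin-cong (λ i → rest (fsuc i) λ ())) ⟩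
  g fzero ℕ.+ a ℕ.+ G                  ≡⟨ ℕ.+-assoc (g fzero) a G ⟩
  g fzero ℕ.+ (a ℕ.+ G)                ≡⟨ cong (g fzero ℕ.+_) (ℕ.+-comm a G) ⟩
  g fzero ℕ.+ (G ℕ.+ a)                ≡⟨ ℕ.+-assoc (g fzero) G a ⟨
  g fzero ℕ.+ G ℕ.+ a                  ∎
  where
  open ≡-Reasoning
  G = ΣFin (λ i → g (fsuc i))
ΣFin-update {ℕ.suc t} f g (fsuc c) a fc≡ rest = begin
  f fzero ℕ.+ ΣFin (λ i → f (fsuc i))        ≡⟨ cong₂ ℕ._+_ (rest fzero λ ()) tail≡ ⟩
  g fzero ℕ.+ (ΣFin (λ i → g (fsuc i)) ℕ.+ a) ≡⟨ ℕ.+-assoc (g fzero) _ a ⟨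
  g fzero ℕ.+ ΣFin (λ i → g (fsuc i)) ℕ.+ a  ∎
  where
  open ≡-Reasoning
  tail≡ : ΣFin (λ i → f (fsuc i)) ≡ ΣFin (λ i → g (fsuc i)) ℕ.+ a
  tail≡ = ΣFin-update (λ i → f (fsuc i)) (λ i → g (fsuc i)) c a fc≡
            (λ k k≢c → rest (fsuc k) (λ eq → k≢c (Fin.suc-injective eq)))

∃-pair⊎ΣFin≤size : ∀ {t} (f : Fin t → ℕ) → Σ (Fin t) (λ c → 2 ℕ.≤ f c) ⊎ ΣFin f ℕ.≤ t
∃-pair⊎ΣFin≤size {ℕ.zero}  f = inj₂ ℕ.z≤n
∃-pair⊎ΣFin≤size {ℕ.suc t} f with f fzero ℕ.≤? 1 | ∃-pair⊎ΣFin≤size (λ i → f (fsuc i))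
... | no  f0≰1 | _              = inj₁ (fzero , ℕ.≰⇒> f0≰1)
... | yes _    | inj₁ (c , 2≤c) = inj₁ (fsuc c , 2≤c)
... | yes f0≤1 | inj₂ rest≤t    = inj₂ (ℕ.+-mono-≤ f0≤1 rest≤t)

module _ {n t : ℕ} (D : Dist n t) (x y : Fin n) (c : Fin t) where

  move-other-colour : ∀ w k → k ≢ c → move D x y c w k ≡ D w k
  move-other-colour w k k≢c with k ≟ c
  ... | no  _   = refl
  ... | yes k≡c = ⊥-elim (k≢c k≡c)

  move-source : move D x y c x c ≡ D x c ∸ 2
  move-source with c ≟ c
  ... | no c≢c = ⊥-elim (c≢c refl)
  ... | yes _ with x ≟ x
  ...   | no x≢x = ⊥-elim (x≢x refl)
  ...   | yes _  = refl

  move-target : x ≢ y → move D x y c y c ≡ D y c ℕ.+ 1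
  move-target x≢y with c ≟ c
  ... | no c≢c = ⊥-elim (c≢c refl)
  ... | yes _ with y ≟ x
  ...   | yes y≡x = ⊥-elim (x≢y (≡.sym y≡x))
  ...   | no _ with y ≟ y
  ...     | no y≢y = ⊥-elim (y≢y refl)
  ...     | yes _  = refl

  total-move-source : 2 ℕ.≤ D x c → total D x ≡ total (move D x y c) x ℕ.+ 2
  total-move-source 2≤Dxc = ΣFin-update (D x) (move D x y c x) c 2
    (trans (≡.sym (ℕ.m∸n+n≡m 2≤Dxc)) (cong (ℕ._+ 2) (≡.sym move-source)))
    (λ k k≢c → ≡.sym (move-other-colour x k k≢c))

  total-move-target : x ≢ y → total (move D x y c) y ≡ total D y ℕ.+ 1
  total-move-target x≢y = ΣFin-update (move D x y c y) (D y) c 1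
    (move-target x≢y) (move-other-colour y)

module _ {n t : ℕ} (G : Graph n) (v u : Fin n) (adj : Adj G v u) where

  private
    v≢u : v ≢ u
    v≢u refl = irrefl G adj

  PebbledToNeighbour : Dist n t → Set
  PebbledToNeighbour D = Σ (Dist n t) λ D' → Σ ℕ λ k → StepsFromTo G v u D D' ×
    total D' u ≡ total D u ℕ.+ k × total D v ℕ.≤ t ℕ.+ 2 ℕ.* k

  pebble-to-neighbour : (D : Dist n t) → PebbledToNeighbour D
  pebble-to-neighbour D = go D (<-wellFounded (total D v))
    where
    go : (D : Dist n t) → Acc _<_ (total D v) → PebbledToNeighbour D
    go D _ with ∃-pair⊎ΣFin≤size (D v)
    go D _         | inj₂ Dv≤t = D , 0 , ε , ≡.sym (ℕ.+-identityʳ _) , ℕ.≤-trans Dv≤t (ℕ.m≤m+n t 0)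
    go D (acc rec) | inj₁ (c , 2≤Dvc)
      with go (move D v u c) (rec (subst (total (move D v u c) v <_)
                                   (≡.sym (total-move-source D v u c 2≤Dvc)) (ℕ.m<m+n _ ℕ.z<s)))
    ... | D' , k , steps , gained , drained =
      D' , ℕ.suc k , (adj , c , 2≤Dvc , λ _ _ → refl) ◅ steps , gained′ , drained′
      where
      gained′ : total D' u ≡ total D u ℕ.+ ℕ.suc k
      gained′ = begin
        total D' u                         ≡⟨ gained ⟩
        total (move D v u c) u ℕ.+ k       ≡⟨ cong (ℕ._+ k) (total-move-target D v u c v≢u) ⟩
        total D u ℕ.+ 1 ℕ.+ k              ≡⟨ ℕ.+-assoc (total D u) 1 k ⟩
        total D u ℕ.+ ℕ.suc k              ∎
        where open ≡-Reasoning
      drained′ : total D v ℕ.≤ t ℕ.+ 2 ℕ.* ℕ.suc k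
      drained′ = begin
        total D v                          ≡⟨ total-move-source D v u c 2≤Dvc ⟩
        total (move D v u c) v ℕ.+ 2       ≤⟨ ℕ.+-monoˡ-≤ 2 drained ⟩
        t ℕ.+ 2 ℕ.* k ℕ.+ 2                ≡⟨ ℕ.+-assoc t (2 ℕ.* k) 2 ⟩
        t ℕ.+ (2 ℕ.* k ℕ.+ 2)              ≡⟨ cong (t ℕ.+_) (ℕ.+-comm (2 ℕ.* k) 2) ⟩
        t ℕ.+ (2 ℕ.+ 2 ℕ.* k)              ≡⟨ cong (t ℕ.+_) (ℕ.*-suc 2 k) ⟨
        t ℕ.+ 2 ℕ.* ℕ.suc k                ∎
        where open ℕ.≤-Reasoning

+[m+n]-+m≡+n : ∀ m n → + (m ℕ.+ n) - + m ≡ + n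
+[m+n]-+m≡+n m n = begin
  + (m ℕ.+ n) - + m   ≡⟨ ℤ.m-n≡m⊖n (m ℕ.+ n) m ⟩
  (m ℕ.+ n) ℤ.⊖ m     ≡⟨ ℤ.≤-⊖ (ℕ.m≤m+n m n) ⟩
  + (m ℕ.+ n ∸ m)     ≡⟨ cong +_ (ℕ.m+n∸m≡n m n) ⟩
  + n                 ∎
  where open ≡-Reasoning

i≤2*k⇒i/2≤k : ∀ {i} k → i ≤ + (2 ℕ.* k) → i / + 2 ≤ + k
i≤2*k⇒i/2≤k {i} k i≤2k = ℤ.*-cancelʳ-≤-pos (i / + 2) (+ k) (+ 2) (begin
  i / + 2 ℤ.* + 2   ≤⟨ [n/d]*d≤n i (+ 2) ⟩
  i                 ≤⟨ i≤2k ⟩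
  + (2 ℕ.* k)       ≡⟨ cong +_ (ℕ.*-comm 2 k) ⟩
  + (k ℕ.* 2)       ≡⟨ ℤ.pos-* k 2 ⟩
  + k ℤ.* + 2       ∎)
  where open ℤ.≤-Reasoning

lemma2p2 : ∀ {n t : ℕ} (G : Graph n) (D : Dist n t) (v : Fin n) →
    t < total D v →
    (E : ℤ) → E ≤ + (total D v ∸ t) →
    (u : Fin n) → Adj G v u →
    Σ (Dist n t) (λ D' → StepsFromTo G v u D D' ×
    (E / + 2) ≤ (+ total D' u) - (+ total D u))
lemma2p2 {t = t} G D v _ E E≤M∸t u adj with pebble-to-neighbour G v u adj D
... | D' , k , steps , gained , drained = D' , steps , E/2≤gain
  where
  E≤2k : E ≤ + (2 ℕ.* k)
  E≤2k = ℤ.≤-trans E≤M∸t (ℤ.+≤+ (ℕ.m≤n+o⇒m∸n≤o (total D v) t drained))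
  E/2≤gain : E / + 2 ≤ + total D' u - + total D u
  E/2≤gain rewrite gained | +[m+n]-+m≡+n (total D u) k = i≤2*k⇒i/2≤k k E≤2k
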